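{- Let $m\ge 10$. Let $H_{12}$ be the voltage graph over $\mathbb{Z}_m$ built as follows. The tree part: a pinned vertex $x^{*}$ adjacent to $x$; vertices $x_0,x_1,x_{00},x_{01},x_{10},x_{11},x_{010},x_{011},x_{100},x_{101},x_{110},x_{111}$ and $x_{0100},x_{0101},x_{0110},x_{0111},x_{1010},x_{1011},x_{1110},x_{1111}$, each joined to its parent ($x_0,x_1$ to $x$; $x_{b0},x_{b1}$ to $x_b$ when present); a pinned vertex $y^{*}$ adjacent to $y$, and vertices $y_0,y_1,y_{01},y_{10},y_{11},y_{010},y_{011},y_{101},y_{110}$ each joined to its parent ($y_0,y_1$ to $y$, $y_{01}$ to $y_0$, $y_{10},y_{11}$ to $y_1$, $y_{010},y_{011}$ to $y_{01}$, $y_{101}$ to $y_{10}$, $y_{110}$ to $y_{11}$); an identical copy of this last tree with $y$ replaced by $z$ (pinned vertex $z^{*}$); and the edges $x_{00}y_0$, $x_{00}z_0$. All these edges have voltage $0$. Then add the labelled arcs $x_{100}\to y_{10}$ (1), $x_{100}\to z_{10}$ ($-1$), $x_{110}\to y_{11}$ ($-1$), $x_{110}\to z_{11}$ (1), $x_{0100}\to y_{010}$ (2), $x_{0101}\to y_{011}$ (1), $x_{0110}\to y_{101}$ ($-1$), $x_{0111}\to y_{110}$ (1), $x_{1010}\to y_{110}$ ($-2$), $x_{1011}\to y_{101}$ ($-3$), $x_{1110}\to y_{011}$ (2), $x_{1111}\to y_{010}$ (1), $x_{0100}\to z_{101}$ (1), $x_{0101}\to z_{110}$ ($-2$), $x_{0110}\to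 z_{010}$ (1), $x_{0111}\to z_{011}$ ($-1$), $x_{1010}\to z_{010}$ (2), $x_{1011}\to z_{011}$ ($-6$), $x_{1110}\to z_{101}$ ($-2$), $x_{1111}\to z_{110}$ (2). Then the derived graph $(H_{12};m)$ has girth $12$; it is a $(3,m;12)$-graph with three vertices of degree $m$ (namely $x^{*},y^{*},z^{*}$) and $41m$ vertices of degree $3$.
   Context: A voltage graph over $\mathbb{Z}_m$ is a finite directed multigraph with arc labels in $\mathbb{Z}_m$; some degree-$1$ vertices are pinned. Derived graph $(G,m)$: each non-pinned vertex $v$ gives $m$ vertices $v^0,\dots,v^{m-1}$; each pinned vertex $v^{*}$ gives a single vertex; an arc $v\to w$ labelled $a$ between non-pinned vertices gives edges $v^iw^{i+a}$ for all $i$ (indices mod $m$); an edge $v^{*}w$ with $v^{*}$ pinned gives edges $v^{*}w^i$ for all $i$. A $(3,m;g)$-graph is a graph of girth $g$ all of whose vertices have degree $3$ or $m$. -}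

module Defs where

open import Data.Nat as ℕ using (ℕ; zero; suc; _<_)
open import Data.Integer as ℤ using (ℤ; +_; -_; _%ℕ_)
open import Data.Integer.DivMod using (n%ℕd<d)
open import Data.Fin as Fin using (Fin; toℕ; fromℕ<; #_)
open import Data.Fin.Properties using () renaming (_≟_ to _≟F_)
open import Data.List as List using (List; []; _∷_; _++_; concatMap; map; length; lookup; allFin; cartesianProduct)
open import Data.Product using (Σ; _×_; _,_; proj₁; proj₂; ∃-syntax)
open import Data.Sum using (_⊎_; inj₁; inj₂)
open import Data.Sum.Properties using () renaming (≡-dec to ⊎-dec)
open import Data.Product.Properties using () renaming (≡-dec to ×-dec)
open import Data.Bool using (Bool; true; false; if_then_else_)
open import Data.Empty using (⊥)
open import Function.Definitions using (Injective)
open import Relation.Nullary using (¬_; does)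
open import Relation.Binary.PropositionalEquality using (_≡_)
open import Relation.Binary.Definitions using (DecidableEquality)

-- A voltage graph has `pins` pinned vertices (Fin pins), each of degree 1,
-- and `verts` non-pinned vertices (Fin verts).
--   arcs       : labelled arcs v → w (label a ∈ ℤ, read modulo m) between
--                non-pinned vertices (a voltage-0 edge is an arc with label 0)
--   pinEdges   : the edges v* w joining a pinned vertex to a non-pinned one

record VoltageGraph : Set where
  field
    pins     : ℕ
    verts    : ℕ
    arcs     : List (Fin verts × Fin verts × ℤ)
    pinEdges : List (Fin pins × Fin verts)
open VoltageGraph public

-- vertices: inj₁ v*  (one vertex per pinned vertex)
--           inj₂ (v , i)  = v^i  (i ∈ ℤ_m)
DVert : VoltageGraph → ℕ → Set
DVert Γ m = Fin (pins Γ) ⊎ (Fin (verts Γ) × Fin m)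

shift : ∀ {m} → Fin m → ℤ → Fin m
shift {suc m} i a = fromℕ< (n%ℕd<d ((+ toℕ i) ℤ.+ a) (suc m))

allVerts : (Γ : VoltageGraph) (m : ℕ) → List (DVert Γ m)
allVerts Γ m = map inj₁ (allFin (pins Γ)) ++ map inj₂ (cartesianProduct (allFin (verts Γ)) (allFin m))

derivedEdges : (Γ : VoltageGraph) (m : ℕ) → List (DVert Γ m × DVert Γ m)
derivedEdges Γ m =
  concatMap (λ { (v , w , a) → map (λ i → inj₂ (v , i) , inj₂ (w , shift i a)) (allFin m) }) (arcs Γ)
  ++ concatMap (λ { (p , w) → map (λ i → inj₁ p , inj₂ (w , i)) (allFin m) }) (pinEdges Γ)

module _ {V : Set} (_≟_ : DecidableEquality V) where

  count : (V → Bool) → List V → ℕ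
  count p [] = 0
  count p (x ∷ xs) = if p x then suc (count p xs) else count p xs

  -- degree: number of edge-ends at x (a loop would count twice)
  degree : List (V × V) → V → ℕ
  degree es x = count (λ y → does (y ≟ x)) (map proj₁ es)
              ℕ.+ count (λ y → does (y ≟ x)) (map proj₂ es)

Joins : {V : Set} → V × V → V → V → Set
Joins (a , b) x y = (a ≡ x × b ≡ y) ⊎ (a ≡ y × b ≡ x)

next : ∀ {k} → Fin (suc k) → Fin (suc k)
next {k} i with toℕ i ℕ.<? k
... | Relation.Nullary.yes p = Fin.suc (fromℕ< p)
... | Relation.Nullary.no _  = Fin.zero

HasCycle : {V : Set} → List (V × V) → ℕ → Set
HasCycle es zero = ⊥
HasCycle {V} es (suc k) =
  Σ (Fin (suc k) → V) λ v → Σ (Fin (suc k) → Fin (length es)) λ e →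
    Injective _≡_ _≡_ v × Injective _≡_ _≡_ e ×
    (∀ j → Joins (lookup es (e j)) (v j) (v (next j)))

HasGirth : {V : Set} → List (V × V) → ℕ → Set
HasGirth es g = HasCycle es g × (∀ k → k < g → ¬ HasCycle es k)

DVert-≟ : (Γ : VoltageGraph) (m : ℕ) → DecidableEquality (DVert Γ m)
DVert-≟ Γ m = ⊎-dec _≟F_ (×-dec _≟F_ _≟F_)

degreeD : (Γ : VoltageGraph) (m : ℕ) → DVert Γ m → ℕ
degreeD Γ m = degree (DVert-≟ Γ m) (derivedEdges Γ m)

Is3mGraph : (Γ : VoltageGraph) (m g : ℕ) → Set
Is3mGraph Γ m g = HasGirth (derivedEdges Γ m) g ×
  (∀ (x : DVert Γ m) → degreeD Γ m x ≡ 3 ⊎ degreeD Γ m x ≡ m)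

numOfDegree : (Γ : VoltageGraph) (m d : ℕ) → ℕ
numOfDegree Γ m d = count (DVert-≟ Γ m) (λ x → does (degreeD Γ m x ℕ.≟ d)) (allVerts Γ m)

x x0 x1 x00 x01 x10 x11 x010 x011 x100 x101 x110 x111 : Fin 41
x0100 x0101 x0110 x0111 x1010 x1011 x1110 x1111 : Fin 41
y y0 y1 y01 y10 y11 y010 y011 y101 y110 : Fin 41
z z0 z1 z01 z10 z11 z010 z011 z101 z110 : Fin 41
x = # 0 ; x0 = # 1 ; x1 = # 2 ; x00 = # 3 ; x01 = # 4 ; x10 = # 5 ; x11 = # 6
x010 = # 7 ; x011 = # 8 ; x100 = # 9 ; x101 = # 10 ; x110 = # 11 ; x111 = # 12
x0100 = # 13 ; x0101 = # 14 ; x0110 = # 15 ; x0111 = # 16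
x1010 = # 17 ; x1011 = # 18 ; x1110 = # 19 ; x1111 = # 20
y = # 21 ; y0 = # 22 ; y1 = # 23 ; y01 = # 24 ; y10 = # 25 ; y11 = # 26
y010 = # 27 ; y011 = # 28 ; y101 = # 29 ; y110 = # 30
z = # 31 ; z0 = # 32 ; z1 = # 33 ; z01 = # 34 ; z10 = # 35 ; z11 = # 36
z010 = # 37 ; z011 = # 38 ; z101 = # 39 ; z110 = # 40

xStar yStar zStar : Fin 3
xStar = # 0 ; yStar = # 1 ; zStar = # 2

private
  e0 : Fin 41 → Fin 41 → Fin 41 × Fin 41 × ℤ
  e0 a b = a , b , + 0

H12 : VoltageGraph
H12 = record
  { pins = 3
  ; verts = 41
  ; pinEdges = (xStar , x) ∷ (yStar , y) ∷ (zStar , z) ∷ []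
  ; arcs =
      e0 x x0 ∷ e0 x x1 ∷
      e0 x0 x00 ∷ e0 x0 x01 ∷ e0 x1 x10 ∷ e0 x1 x11 ∷
      e0 x01 x010 ∷ e0 x01 x011 ∷ e0 x10 x100 ∷ e0 x10 x101 ∷ e0 x11 x110 ∷ e0 x11 x111 ∷
      e0 x010 x0100 ∷ e0 x010 x0101 ∷ e0 x011 x0110 ∷ e0 x011 x0111 ∷
      e0 x101 x1010 ∷ e0 x101 x1011 ∷ e0 x111 x1110 ∷ e0 x111 x1111 ∷
      e0 y y0 ∷ e0 y y1 ∷ e0 y0 y01 ∷ e0 y1 y10 ∷ e0 y1 y11 ∷
      e0 y01 y010 ∷ e0 y01 y011 ∷ e0 y10 y101 ∷ e0 y11 y110 ∷
      e0 z z0 ∷ e0 z z1 ∷ e0 z0 z01 ∷ e0 z1 z10 ∷ e0 z1 z11 ∷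
      e0 z01 z010 ∷ e0 z01 z011 ∷ e0 z10 z101 ∷ e0 z11 z110 ∷
      e0 x00 y0 ∷ e0 x00 z0 ∷
      (x100 , y10 , + 1) ∷ (x100 , z10 , - (+ 1)) ∷ (x110 , y11 , - (+ 1)) ∷ (x110 , z11 , + 1) ∷
      (x0100 , y010 , + 2) ∷ (x0101 , y011 , + 1) ∷ (x0110 , y101 , - (+ 1)) ∷ (x0111 , y110 , + 1) ∷
      (x1010 , y110 , - (+ 2)) ∷ (x1011 , y101 , - (+ 3)) ∷ (x1110 , y011 , + 2) ∷ (x1111 , y010 , + 1) ∷
      (x0100 , z101 , + 1) ∷ (x0101 , z110 , - (+ 2)) ∷ (x0110 , z010 , + 1) ∷ (x0111 , z011 , - (+ 1)) ∷
      (x1010 , z010 , + 2) ∷ (x1011 , z011 , - (+ 6)) ∷ (x1110 , z101 , - (+ 2)) ∷ (x1111 , z110 , + 2) ∷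
      []
  }

{-# OPTIONS --safe #-}
module Submission where

-- Degrees: an arc of a voltage graph lifts to exactly one edge at each lift of each of its ends, so
-- a lift v^i has the degree of v in the base graph and a pinned vertex has m times its degree; in
-- H₁₂ these base degrees are 3 and 1.
-- Girth: a cycle of the derived graph projects to a closed walk in the base graph which never turns
-- back along its last dart at a non-pinned vertex (it would return to the vertex it came from), and
-- which, if it avoids the pinned vertices, returns to the lift shifted by the sum T of its voltages.
-- An exhaustive search shows that every such walk of length 3 to 11 in H₁₂ avoids the pinned
-- vertices and has 0 < |T| < 10 ≤ m, so it does not close up; lengths 1 and 2 are excluded because
-- H₁₂ has neither loops nor parallel edges.  The 12-cycle x* x⁰ x0⁰ x00⁰ y0⁰ y⁰ y* y¹ y0¹ x00¹ x0¹ x¹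
-- attains the bound.

open import Defs
open import Data.Nat using (ℕ; zero; suc; _+_; _*_; _∸_; _≤_; _<_; _⊔_; _<ᵇ_; z≤n; s≤s)
import Data.Nat.Properties as ℕ
open import Data.Nat.Divisibility using (>⇒∤) renaming (_∣_ to _∣ℕ_)
open import Data.Integer as ℤ using (ℤ; +_; -_; ∣_∣; _⊖_)
import Data.Integer.Properties as ℤ
open import Data.Integer.DivMod using (a≡a%ℕn+[a/ℕn]*n)
open import Data.Integer.Divisibility.Signed using (_∣_; divides; ∣⇒∣ᵤ; ∣m∣n⇒∣m-n)
open import Data.Integer.Tactic.RingSolver using (solve-∀)
open import Data.Fin as Fin using (Fin; toℕ)
open import Data.Fin.Properties using (toℕ-fromℕ<; toℕ-injective; toℕ<n; 0≢1+n; all?) renaming (_≟_ to _≟F_)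
open import Data.Bool using (Bool; true; false; T; not; _∧_; _∨_; if_then_else_)
open import Data.Bool.Properties using (T-∧; T-∨; T-≡)
open import Data.Bool.ListAction using (all)
open import Data.List
  using (List; []; _∷_; _++_; map; concatMap; filter; length; lookup; allFin; tabulate; cartesianProduct)
import Data.List.Properties as List
open import Data.List.Membership.Propositional using (_∈_; find)
open import Data.List.Membership.Propositional.Properties
  using (∈-++⁺ˡ; ∈-++⁺ʳ; ∈-++⁻; ∈-map⁺; ∈-map⁻; ∈-filter⁺; ∈-concatMap⁺; ∈-concatMap⁻;
         ∈-allFin; ∈-lookup)
import Data.List.Membership.DecPropositional as DecMembership
open import Data.List.Relation.Unary.Any as Any using (here; there; index)
open import Data.List.Relation.Unary.Any.Properties using (lookup-index)
open import Data.Vec as Vec using (Vec; []; _∷_)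
open import Data.Vec.Properties using (lookup∘tabulate)
open import Data.Vec.Relation.Unary.All using (All; []; _∷_)
open import Data.Vec.Relation.Unary.All.Properties using (lookup⁺)
open import Data.Maybe as Maybe using (Maybe; just; nothing)
open import Data.Product using (Σ; _×_; _,_; proj₁; proj₂)
import Data.Product.Properties as Product
open import Data.Sum using (_⊎_; inj₁; inj₂; swap)
import Data.Sum as Sum
import Data.Sum.Properties as Sum
open import Data.Unit using (⊤)
open import Data.Empty using (⊥)
open import Function using (_∘_; id; Equivalence; mk⇔)
open import Function.Definitions using (Injective)
open import Relation.Nullary using (¬_; Dec; yes; no; does; contradiction)
open import Relation.Nullary.Decidable using (from-yes; does-⇔; dec-true; dec-false; _×-dec_; _⊎-dec_; _→-dec_)
import Relation.Nullary.Decidable as Dec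
open import Relation.Unary using (Decidable)
open import Relation.Binary.Definitions using (DecidableEquality)
open import Relation.Binary.PropositionalEquality

-- Residues modulo m

module _ {m : ℕ} where

  ∣i∣<m⇒i≡0 : ∀ {i} → + m ∣ i → ∣ i ∣ < m → i ≡ + 0
  ∣i∣<m⇒i≡0 m∣i ∣i∣<m = ℤ.∣i∣≡0⇒i≡0 (small (∣⇒∣ᵤ m∣i) ∣i∣<m)
    where
    small : ∀ {k} → m ∣ℕ k → k < m → k ≡ 0
    small {zero}  _   _   = refl
    small {suc _} m∣k k<m = contradiction m∣k (>⇒∤ k<m)

  residue-injective : ∀ (i j : Fin m) → + m ∣ + toℕ i ℤ.- + toℕ j → i ≡ j
  residue-injective i j m∣i-j =
    toℕ-injective (ℤ.+-injective (ℤ.i-j≡0⇒i≡j _ _ (∣i∣<m⇒i≡0 m∣i-j distance<m)))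
    where
    open ℕ.≤-Reasoning
    distance<m : ∣ + toℕ i ℤ.- + toℕ j ∣ < m
    distance<m = begin-strict
      ∣ + toℕ i ℤ.- + toℕ j ∣  ≡⟨ cong ∣_∣ (ℤ.m-n≡m⊖n (toℕ i) (toℕ j)) ⟩
      ∣ toℕ i ⊖ toℕ j ∣        ≤⟨ ℤ.∣m⊝n∣≤m⊔n (toℕ i) (toℕ j) ⟩
      toℕ i ⊔ toℕ j            <⟨ ℕ.⊔-lub (toℕ<n i) (toℕ<n j) ⟩
      m                        ∎

module _ {n : ℕ} where
  private
    M = suc n

  shift-congruent : ∀ (i : Fin M) a → + M ∣ (+ toℕ i ℤ.+ a) ℤ.- + toℕ (shift i a)
  shift-congruent i a = divides q (begin
      c ℤ.- + toℕ (shift i a)        ≡⟨ cong (λ k → c ℤ.- + k) (toℕ-fromℕ< _) ⟩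
      c ℤ.- + r                      ≡⟨ cong (ℤ._- + r) (a≡a%ℕn+[a/ℕn]*n c M) ⟩
      (+ r ℤ.+ q ℤ.* + M) ℤ.- + r    ≡⟨ cancel (+ r) (q ℤ.* + M) ⟩
      q ℤ.* + M                      ∎)
    where
    open ≡-Reasoning
    c = + toℕ i ℤ.+ a
    r = c ℤ.%ℕ M
    q = c ℤ./ℕ M
    cancel : ∀ r d → (r ℤ.+ d) ℤ.- r ≡ d
    cancel = solve-∀

  shift-unique : ∀ (i j : Fin M) a → + M ∣ (+ toℕ i ℤ.+ a) ℤ.- + toℕ j → shift i a ≡ j
  shift-unique i j a M∣i+a-j = residue-injective _ _
    (subst (+ M ∣_) (regroup (+ toℕ i ℤ.+ a) _ _) (∣m∣n⇒∣m-n M∣i+a-j (shift-congruent i a)))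
    where
    regroup : ∀ c s j → (c ℤ.- j) ℤ.- (c ℤ.- s) ≡ s ℤ.- j
    regroup = solve-∀

  shift-+ : ∀ (i : Fin M) a b → shift (shift i a) b ≡ shift i (a ℤ.+ b)
  shift-+ i a b = shift-unique _ _ b
    (subst (+ M ∣_) (regroup (+ toℕ i) a b _ _)
      (∣m∣n⇒∣m-n (shift-congruent i (a ℤ.+ b)) (shift-congruent i a)))
    where
    regroup : ∀ c a b s₁ s₂ →
      ((c ℤ.+ (a ℤ.+ b)) ℤ.- s₂) ℤ.- ((c ℤ.+ a) ℤ.- s₁) ≡ (s₁ ℤ.+ b) ℤ.- s₂
    regroup = solve-∀

  shift-identityʳ : ∀ (i : Fin M) → shift i (+ 0) ≡ i
  shift-identityʳ i = shift-unique i i (+ 0) (divides (+ 0) (vanish (+ toℕ i) (+ M)))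
    where
    vanish : ∀ c d → (c ℤ.+ + 0) ℤ.- c ≡ + 0 ℤ.* d
    vanish = solve-∀

  shift-inverseʳ : ∀ (i : Fin M) a → shift (shift i a) (- a) ≡ i
  shift-inverseʳ i a = trans (shift-+ i a (- a)) (trans (cong (shift i) (ℤ.+-inverseʳ a)) (shift-identityʳ i))

  shift-inverseˡ : ∀ (i : Fin M) a → shift (shift i (- a)) a ≡ i
  shift-inverseˡ i a = trans (shift-+ i (- a) a) (trans (cong (shift i) (ℤ.+-inverseˡ a)) (shift-identityʳ i))

  shift-≢ : ∀ (i : Fin M) {a} → 0 < ∣ a ∣ → ∣ a ∣ < M → shift i a ≢ i
  shift-≢ i {a} 0<∣a∣ ∣a∣<M shift≡i = ℕ.<⇒≢ 0<∣a∣ (sym (cong ∣_∣ a≡0))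
    where
    drop : ∀ c a → (c ℤ.+ a) ℤ.- c ≡ a
    drop = solve-∀
    M∣a : + M ∣ a
    M∣a = subst (+ M ∣_) (trans (cong (λ j → (+ toℕ i ℤ.+ a) ℤ.- + toℕ j) shift≡i) (drop (+ toℕ i) a))
                (shift-congruent i a)
    a≡0 : a ≡ + 0
    a≡0 = ∣i∣<m⇒i≡0 M∣a ∣a∣<M

module _ {P : Set} where

  T-does⁻ : (P? : Dec P) → T (does P?) → P
  T-does⁻ (yes p) _ = p

  T-does⁺ : (P? : Dec P) → P → T (does P?)
  T-does⁺ (yes _) _  = _
  T-does⁺ (no ¬p) p = ¬p p

  T-not-does⁻ : (P? : Dec P) → T (not (does P?)) → ¬ P
  T-not-does⁻ (no ¬p) _ = ¬p

T-all-∈ : ∀ {A : Set} (p : A → Bool) {xs a} → T (all p xs) → a ∈ xs → T (p a)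
T-all-∈ p {_ ∷ _}  ok (here refl) = proj₁ (Equivalence.to T-∧ ok)
T-all-∈ p {a ∷ as} ok (there a∈)  = T-all-∈ p (proj₂ (Equivalence.to (T-∧ {p a}) ok)) a∈

-- Defs.count never consults its decidable equality; tally is the same count without it, so that
-- counts can be transported along maps between element types.
tally : {A : Set} → (A → Bool) → List A → ℕ
tally p []       = 0
tally p (a ∷ as) = if p a then suc (tally p as) else tally p as

count≡tally : ∀ {A : Set} (_≟_ : DecidableEquality A) p xs → count _≟_ p xs ≡ tally p xs
count≡tally _≟_ p []       = refl
count≡tally _≟_ p (a ∷ as) with p a
... | true  = cong suc (count≡tally _≟_ p as)
... | false = count≡tally _≟_ p as

module _ {A : Set} where

  tally-++ : ∀ (p : A → Bool) xs ys → tally p (xs ++ ys) ≡ tally p xs + tally p ys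
  tally-++ p []       ys = refl
  tally-++ p (a ∷ as) ys with p a
  ... | true  = cong suc (tally-++ p as ys)
  ... | false = tally-++ p as ys

  tally-cong : ∀ {p q : A → Bool} → (∀ a → p a ≡ q a) → ∀ xs → tally p xs ≡ tally q xs
  tally-cong p≗q []       = refl
  tally-cong p≗q (a ∷ as) rewrite p≗q a = cong (λ k → if _ then suc k else k) (tally-cong p≗q as)

  tally-false : ∀ (xs : List A) → tally (λ _ → false) xs ≡ 0
  tally-false []       = refl
  tally-false (_ ∷ as) = tally-false as

  tally-true : ∀ (xs : List A) → tally (λ _ → true) xs ≡ length xs
  tally-true []       = refl
  tally-true (_ ∷ as) = cong suc (tally-true as)

  tally-const : ∀ b (xs : List A) → tally (λ _ → b) xs ≡ (if b then length xs else 0)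
  tally-const true  xs = tally-true xs
  tally-const false xs = tally-false xs

  tally-mono : ∀ {p q : A → Bool} → (∀ a → T (p a) → T (q a)) → ∀ xs → tally p xs ≤ tally q xs
  tally-mono         p⇒q []       = z≤n
  tally-mono {p} {q} p⇒q (a ∷ as) with p a in pa | q a in qa
  ... | true  | true  = s≤s (tally-mono p⇒q as)
  ... | false | true  = ℕ.m≤n⇒m≤1+n (tally-mono p⇒q as)
  ... | false | false = tally-mono p⇒q as
  ... | true  | false = contradiction (p⇒q a (subst T (sym pa) _)) (subst T qa)

  tally-∨ : ∀ (p q : A → Bool) xs → tally (λ a → p a ∨ q a) xs ≤ tally p xs + tally q xs
  tally-∨ p q []       = z≤n
  tally-∨ p q (a ∷ as) with p a | q a
  ... | true  | true  = s≤s (ℕ.≤-trans (tally-∨ p q as) (ℕ.+-monoʳ-≤ (tally p as) (ℕ.n≤1+n _)))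
  ... | true  | false = s≤s (tally-∨ p q as)
  ... | false | true  = ℕ.≤-trans (s≤s (tally-∨ p q as)) (ℕ.≤-reflexive (sym (ℕ.+-suc _ _)))
  ... | false | false = tally-∨ p q as

  tally-filter : ∀ {P : A → Set} (P? : Decidable P) xs → tally (λ a → does (P? a)) xs ≡ length (filter P? xs)
  tally-filter P? []       = refl
  tally-filter P? (a ∷ as) with does (P? a)
  ... | true  = cong suc (tally-filter P? as)
  ... | false = tally-filter P? as

  length-map-filter : ∀ {B : Set} {P : A → Set} (f : A → B) (P? : Decidable P) xs →
    length (map f (filter P? xs)) ≡ tally (λ a → does (P? a)) xs
  length-map-filter f P? xs = trans (List.length-map f (filter P? xs)) (sym (tally-filter P? xs))

  tally-lookup : ∀ (p : A → Bool) xs i → T (p (lookup xs i)) → 1 ≤ tally p xs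
  tally-lookup p (a ∷ as) Fin.zero    hit with p a
  ... | true = s≤s z≤n
  tally-lookup p (a ∷ as) (Fin.suc i) hit with p a
  ... | true  = s≤s z≤n
  ... | false = tally-lookup p as i hit

  tally-lookup₂ : ∀ (p : A → Bool) xs {i j} → i ≢ j →
    T (p (lookup xs i)) → T (p (lookup xs j)) → 2 ≤ tally p xs
  tally-lookup₂ p (a ∷ as) {Fin.zero}  {Fin.zero}  i≢j _ _ = contradiction refl i≢j
  tally-lookup₂ p (a ∷ as) {Fin.zero}  {Fin.suc j} _ hit-i hit-j with p a
  ... | true = s≤s (tally-lookup p as j hit-j)
  tally-lookup₂ p (a ∷ as) {Fin.suc i} {Fin.zero}  _ hit-i hit-j with p a
  ... | true = s≤s (tally-lookup p as i hit-i)
  tally-lookup₂ p (a ∷ as) {Fin.suc i} {Fin.suc j} i≢j hit-i hit-j with p a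
  ... | true  = ℕ.m≤n⇒m≤1+n (tally-lookup₂ p as (i≢j ∘ cong Fin.suc) hit-i hit-j)
  ... | false = tally-lookup₂ p as (i≢j ∘ cong Fin.suc) hit-i hit-j

module _ {A B : Set} where

  length-cartesianProduct : ∀ (xs : List A) (ys : List B) →
    length (cartesianProduct xs ys) ≡ length xs * length ys
  length-cartesianProduct []       ys = refl
  length-cartesianProduct (a ∷ as) ys = trans (List.length-++ (map (a ,_) ys))
    (cong₂ _+_ (List.length-map (a ,_) ys) (length-cartesianProduct as ys))

  tally-map : ∀ (p : B → Bool) (f : A → B) xs → tally p (map f xs) ≡ tally (λ a → p (f a)) xs
  tally-map p f []       = refl
  tally-map p f (a ∷ as) with p (f a)
  ... | true  = cong suc (tally-map p f as)
  ... | false = tally-map p f as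

  tally-concatMap : ∀ {p : B → Bool} {q : A → Bool} {F : A → List B} {k} →
    (∀ a → tally p (F a) ≡ (if q a then k else 0)) → ∀ xs → tally p (concatMap F xs) ≡ tally q xs * k
  tally-concatMap         h []       = refl
  tally-concatMap {p} {q} {F} {k} h (a ∷ as)
    rewrite tally-++ p (F a) (concatMap F as) | h a with q a
  ... | true  = cong (λ t → k + t) (tally-concatMap h as)
  ... | false = tally-concatMap h as

  tally-concatMap-≤ : ∀ {p : B → Bool} {q : A → Bool} {F : A → List B} →
    (∀ a → tally p (F a) ≤ (if q a then 1 else 0)) → ∀ xs → tally p (concatMap F xs) ≤ tally q xs
  tally-concatMap-≤         h []       = z≤n
  tally-concatMap-≤ {p} {q} {F} h (a ∷ as)
    rewrite tally-++ p (F a) (concatMap F as) with q a | h a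
  ... | true  | ≤1 = ℕ.+-mono-≤ ≤1 (tally-concatMap-≤ h as)
  ... | false | ≤0 = ℕ.+-mono-≤ ≤0 (tally-concatMap-≤ h as)

  tally-concatMap-indicator : ∀ {p : B → Bool} {q : A → Bool} {F : A → List B} →
    (∀ a → tally p (F a) ≡ (if q a then 1 else 0)) → ∀ xs → tally p (concatMap F xs) ≡ tally q xs
  tally-concatMap-indicator h xs = trans (tally-concatMap h xs) (ℕ.*-identityʳ _)

  tally-concatMap-none : ∀ {p : B → Bool} {F : A → List B} →
    (∀ a → tally p (F a) ≡ 0) → ∀ xs → tally p (concatMap F xs) ≡ 0
  tally-concatMap-none h xs =
    trans (tally-concatMap {q = λ _ → false} {k = 0} h xs) (cong (_* 0) (tally-false xs))

tally-tabulate-suc : ∀ {n} (p : Fin (suc n) → Bool) → tally p (tabulate Fin.suc) ≡ tally (p ∘ Fin.suc) (allFin n)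
tally-tabulate-suc {n} p =
  trans (cong (tally p) (sym (List.map-tabulate id Fin.suc))) (tally-map p Fin.suc (allFin n))

tally-allFin-≟ : ∀ {n} (j : Fin n) → tally (λ i → does (i ≟F j)) (allFin n) ≡ 1
tally-allFin-≟ {suc n} Fin.zero    =
  cong suc (trans (tally-tabulate-suc {n} (λ i → does (i ≟F Fin.zero))) (tally-false (allFin n)))
tally-allFin-≟ {suc n} (Fin.suc j) =
  trans (tally-tabulate-suc {n} (λ i → does (i ≟F Fin.suc j))) (tally-allFin-≟ j)

tally-allFin-≤ : ∀ {n} {p : Fin n → Bool} b (j : Fin n) →
  (∀ i → T (p i) → T b × i ≡ j) → tally p (allFin n) ≤ (if b then 1 else 0)
tally-allFin-≤ {n} {p} b j only-j = ℕ.≤-trans (tally-mono hit (allFin n)) (ℕ.≤-reflexive (bound b))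
  where
  hit : ∀ i → T (p i) → T (b ∧ does (i ≟F j))
  hit i pi with only-j i pi
  ... | b-holds , refl = Equivalence.from T-∧ (b-holds , T-does⁺ (i ≟F i) refl)
  bound : ∀ b → tally (λ i → b ∧ does (i ≟F j)) (allFin n) ≡ (if b then 1 else 0)
  bound false = tally-false (allFin n)
  bound true  = tally-allFin-≟ j

-- The base graph and its darts

module _ (Γ : VoltageGraph) where

  BVert : Set
  BVert = Fin (pins Γ) ⊎ Fin (verts Γ)

  Dart : Set
  Dart = BVert × ℤ

  BVert-≟ : DecidableEquality BVert
  BVert-≟ = Sum.≡-dec _≟F_ _≟F_

  private
    _≟B_ = BVert-≟

  all-BVert? : ∀ {P : BVert → Set} → (∀ b → Dec (P b)) → Dec (∀ b → P b)
  all-BVert? P? = Dec.map′ (λ (onPins , onVerts) → Sum.[ onPins , onVerts ])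
                           (λ every → every ∘ inj₁ , every ∘ inj₂)
                           (all? (P? ∘ inj₁) ×-dec all? (P? ∘ inj₂))

  isPinned : BVert → Bool
  isPinned (inj₁ _) = true
  isPinned (inj₂ _) = false

  outgoing incoming pinning : Fin (verts Γ) → List Dart
  outgoing u = map (λ (_ , w , a) → inj₂ w , a)   (filter (λ (v , _) → v ≟F u) (arcs Γ))
  incoming u = map (λ (v , _ , a) → inj₂ v , - a) (filter (λ (_ , w , _) → w ≟F u) (arcs Γ))
  pinning  u = map (λ (q , _) → inj₁ q , + 0)    (filter (λ (_ , w) → w ≟F u) (pinEdges Γ))

  darts : BVert → List Dart
  darts (inj₁ p) = map (λ (_ , w) → inj₂ w , + 0) (filter (λ (q , _) → q ≟F p) (pinEdges Γ))
  darts (inj₂ u) = outgoing u ++ incoming u ++ pinning u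

  edgesFromTo : BVert → BVert → ℕ
  edgesFromTo b c =
      tally (λ (v , w , _) → does (inj₂ v ≟B b) ∧ does (inj₂ w ≟B c)) (arcs Γ)
    + tally (λ (p , w) → does (inj₁ p ≟B b) ∧ does (inj₂ w ≟B c)) (pinEdges Γ)

  multiplicity : BVert → BVert → ℕ
  multiplicity b c = edgesFromTo b c + edgesFromTo c b

-- Lifts of arcs and pinned edges

module _ (Γ : VoltageGraph) (n : ℕ) where
  private
    M = suc n
    D = DVert Γ M
    _≟D_ = DVert-≟ Γ M
    _≟B_ = BVert-≟ Γ
    es = derivedEdges Γ M

  arcLift : Fin (verts Γ) × Fin (verts Γ) × ℤ → List (D × D)
  arcLift (v , w , a) = map (λ i → inj₂ (v , i) , inj₂ (w , shift i a)) (allFin M)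

  pinLift : Fin (pins Γ) × Fin (verts Γ) → List (D × D)
  pinLift (p , w) = map (λ i → inj₁ p , inj₂ (w , i)) (allFin M)

  tally-arcLift : ∀ (q : D × D → Bool) v w a →
    tally q (arcLift (v , w , a)) ≡ tally (λ i → q (inj₂ (v , i) , inj₂ (w , shift i a))) (allFin M)
  tally-arcLift q v w a = tally-map q _ (allFin M)

  tally-pinLift : ∀ (q : D × D → Bool) p w →
    tally q (pinLift (p , w)) ≡ tally (λ i → q (inj₁ p , inj₂ (w , i))) (allFin M)
  tally-pinLift q p w = tally-map q _ (allFin M)

  tally-derivedEdges : ∀ (q : D × D → Bool) →
    tally q es ≡ tally q (concatMap arcLift (arcs Γ)) + tally q (concatMap pinLift (pinEdges Γ))
  tally-derivedEdges q = tally-++ q (concatMap arcLift (arcs Γ)) _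

  degree-as-tally : ∀ (X : D) →
    degreeD Γ M X ≡ tally (λ e → does (proj₁ e ≟D X)) es + tally (λ e → does (proj₂ e ≟D X)) es
  degree-as-tally X = cong₂ _+_
    (trans (count≡tally _≟D_ _ (map proj₁ es)) (tally-map _ proj₁ es))
    (trans (count≡tally _≟D_ _ (map proj₂ es)) (tally-map _ proj₂ es))

  tally-lift-at : ∀ (σ σ⁻¹ : Fin M → Fin M) → (∀ i j → σ i ≡ j → i ≡ σ⁻¹ j) → (∀ j → σ (σ⁻¹ j) ≡ j) →
    ∀ v u j → tally (λ i → does (inj₂ (v , σ i) ≟D inj₂ (u , j))) (allFin M)
              ≡ (if does (v ≟F u) then 1 else 0)
  tally-lift-at σ σ⁻¹ to from v u j with v ≟F u
  ... | no _     = tally-false (allFin M)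
  ... | yes refl = trans (tally-cong σ-hits (allFin M)) (tally-allFin-≟ (σ⁻¹ j))
    where
    σ-hits : ∀ i → does (σ i ≟F j) ≡ does (i ≟F σ⁻¹ j)
    σ-hits i = does-⇔ (mk⇔ (to i j) λ { refl → from j }) (σ i ≟F j) (i ≟F σ⁻¹ j)

  length-darts-lift : ∀ u → length (darts Γ (inj₂ u)) ≡
      tally (λ (v , _) → does (v ≟F u)) (arcs Γ)
    + (tally (λ (_ , w , _) → does (w ≟F u)) (arcs Γ) + tally (λ (_ , w) → does (w ≟F u)) (pinEdges Γ))
  length-darts-lift u = trans (List.length-++ (outgoing Γ u))
    (cong₂ _+_ (length-map-filter _ _ (arcs Γ))
      (trans (List.length-++ (incoming Γ u))
        (cong₂ _+_ (length-map-filter _ _ (arcs Γ)) (length-map-filter _ _ (pinEdges Γ)))))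

  degree-lift : ∀ u j → degreeD Γ M (inj₂ (u , j)) ≡ length (darts Γ (inj₂ u))
  degree-lift u j = begin
      degreeD Γ M X
    ≡⟨ degree-as-tally X ⟩
      tally (λ e → does (proj₁ e ≟D X)) es + tally (λ e → does (proj₂ e ≟D X)) es
    ≡⟨ cong₂ _+_ (tally-derivedEdges _) (tally-derivedEdges _) ⟩
        (tally (λ e → does (proj₁ e ≟D X)) (concatMap arcLift (arcs Γ))
      + tally (λ e → does (proj₁ e ≟D X)) (concatMap pinLift (pinEdges Γ)))
      + (tally (λ e → does (proj₂ e ≟D X)) (concatMap arcLift (arcs Γ))
      + tally (λ e → does (proj₂ e ≟D X)) (concatMap pinLift (pinEdges Γ)))
    ≡⟨ cong₂ _+_
         (cong₂ _+_ (tally-concatMap-indicator sources (arcs Γ)) (tally-concatMap-none pinned (pinEdges Γ)))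
         (cong₂ _+_ (tally-concatMap-indicator targets (arcs Γ)) (tally-concatMap-indicator ends (pinEdges Γ))) ⟩
      (outdeg + 0) + (indeg + pindeg)
    ≡⟨ cong (_+ (indeg + pindeg)) (ℕ.+-identityʳ outdeg) ⟩
      outdeg + (indeg + pindeg)
    ≡⟨ length-darts-lift u ⟨
      length (darts Γ (inj₂ u))
    ∎
    where
    open ≡-Reasoning
    X = inj₂ (u , j)
    outdeg = tally (λ (v , _) → does (v ≟F u)) (arcs Γ)
    indeg = tally (λ (_ , w , _) → does (w ≟F u)) (arcs Γ)
    pindeg = tally (λ (_ , w) → does (w ≟F u)) (pinEdges Γ)
    sources : ∀ α → tally (λ e → does (proj₁ e ≟D X)) (arcLift α) ≡ (if does (proj₁ α ≟F u) then 1 else 0)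
    sources (v , w , a) = trans (tally-arcLift (λ e → does (proj₁ e ≟D X)) v w a)
      (tally-lift-at (λ i → i) (λ i → i) (λ _ _ eq → eq) (λ _ → refl) v u j)
    targets : ∀ α → tally (λ e → does (proj₂ e ≟D X)) (arcLift α)
                    ≡ (if does (proj₁ (proj₂ α) ≟F u) then 1 else 0)
    targets (v , w , a) = trans (tally-arcLift (λ e → does (proj₂ e ≟D X)) v w a)
      (tally-lift-at (λ i → shift i a) (λ i → shift i (- a))
        (λ i _ eq → trans (sym (shift-inverseʳ i a)) (cong (λ k → shift k (- a)) eq))
        (λ k → shift-inverseˡ k a) w u j)
    pinned : ∀ π → tally (λ e → does (proj₁ e ≟D X)) (pinLift π) ≡ 0
    pinned (p , w) = trans (tally-pinLift (λ e → does (proj₁ e ≟D X)) p w)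
      (tally-false (allFin M))
    ends : ∀ π → tally (λ e → does (proj₂ e ≟D X)) (pinLift π) ≡ (if does (proj₂ π ≟F u) then 1 else 0)
    ends (p , w) = trans (tally-pinLift (λ e → does (proj₂ e ≟D X)) p w)
      (tally-lift-at (λ i → i) (λ i → i) (λ _ _ eq → eq) (λ _ → refl) w u j)

  degree-pinned : ∀ p → degreeD Γ M (inj₁ p) ≡ length (darts Γ (inj₁ p)) * M
  degree-pinned p = begin
      degreeD Γ M X
    ≡⟨ degree-as-tally X ⟩
      tally (λ e → does (proj₁ e ≟D X)) es + tally (λ e → does (proj₂ e ≟D X)) es
    ≡⟨ cong₂ _+_ (tally-derivedEdges _) (tally-derivedEdges _) ⟩
        (tally (λ e → does (proj₁ e ≟D X)) (concatMap arcLift (arcs Γ))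
      + tally (λ e → does (proj₁ e ≟D X)) (concatMap pinLift (pinEdges Γ)))
      + (tally (λ e → does (proj₂ e ≟D X)) (concatMap arcLift (arcs Γ))
      + tally (λ e → does (proj₂ e ≟D X)) (concatMap pinLift (pinEdges Γ)))
    ≡⟨ cong₂ _+_ (cong₂ _+_ (tally-concatMap-none sources (arcs Γ)) (tally-concatMap atPin (pinEdges Γ)))
                 (cong₂ _+_ (tally-concatMap-none targets (arcs Γ)) (tally-concatMap-none ends (pinEdges Γ))) ⟩
      tally (λ (q , _) → does (q ≟F p)) (pinEdges Γ) * M + 0
    ≡⟨ ℕ.+-identityʳ _ ⟩
      tally (λ (q , _) → does (q ≟F p)) (pinEdges Γ) * M
    ≡⟨ cong (_* M) (length-map-filter _ _ (pinEdges Γ)) ⟨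
      length (darts Γ (inj₁ p)) * M
    ∎
    where
    open ≡-Reasoning
    X = inj₁ p
    sources : ∀ α → tally (λ e → does (proj₁ e ≟D X)) (arcLift α) ≡ 0
    sources (v , w , a) = trans (tally-arcLift (λ e → does (proj₁ e ≟D X)) v w a) (tally-false (allFin M))
    atPin : ∀ π → tally (λ e → does (proj₁ e ≟D X)) (pinLift π) ≡ (if does (proj₁ π ≟F p) then M else 0)
    atPin (q , w) = begin
        tally (λ e → does (proj₁ e ≟D X)) (pinLift (q , w))
      ≡⟨ tally-pinLift (λ e → does (proj₁ e ≟D X)) q w ⟩
        tally (λ _ → does (q ≟F p)) (allFin M)
      ≡⟨ tally-const (does (q ≟F p)) (allFin M) ⟩
        (if does (q ≟F p) then length (allFin M) else 0)
      ≡⟨ cong (λ l → if does (q ≟F p) then l else 0) (List.length-tabulate (λ i → i)) ⟩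
        (if does (q ≟F p) then M else 0)
      ∎
    targets : ∀ α → tally (λ e → does (proj₂ e ≟D X)) (arcLift α) ≡ 0
    targets (v , w , a) = trans (tally-arcLift (λ e → does (proj₂ e ≟D X)) v w a) (tally-false (allFin M))
    ends : ∀ π → tally (λ e → does (proj₂ e ≟D X)) (pinLift π) ≡ 0
    ends (q , w) = trans (tally-pinLift (λ e → does (proj₂ e ≟D X)) q w)
      (tally-false (allFin M))

  numOfDegree-≡ : ∀ {δ Δ} → (∀ p → degreeD Γ M (inj₁ p) ≡ Δ) → (∀ u j → degreeD Γ M (inj₂ (u , j)) ≡ δ) →
    ∀ d → numOfDegree Γ M d
          ≡ (if does (Δ ℕ.≟ d) then pins Γ else 0) + (if does (δ ℕ.≟ d) then verts Γ * M else 0)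
  numOfDegree-≡ {δ} {Δ} pinned lifted d = begin
      numOfDegree Γ M d
    ≡⟨ count≡tally _≟D_ has-d (allVerts Γ M) ⟩
      tally has-d (map inj₁ (allFin (pins Γ)) ++ map inj₂ grid)
    ≡⟨ tally-++ has-d (map inj₁ (allFin (pins Γ))) _ ⟩
      tally has-d (map inj₁ (allFin (pins Γ))) + tally has-d (map inj₂ grid)
    ≡⟨ cong₂ _+_
         (trans (tally-map has-d inj₁ (allFin (pins Γ)))
                (tally-cong (λ p → cong (λ k → does (k ℕ.≟ d)) (pinned p)) (allFin (pins Γ))))
         (trans (tally-map has-d inj₂ grid)
                (tally-cong (λ (u , j) → cong (λ k → does (k ℕ.≟ d)) (lifted u j)) grid)) ⟩
      tally (λ _ → does (Δ ℕ.≟ d)) (allFin (pins Γ)) + tally (λ _ → does (δ ℕ.≟ d)) grid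
    ≡⟨ cong₂ _+_ (tally-const _ (allFin (pins Γ))) (tally-const _ grid) ⟩
      (if does (Δ ℕ.≟ d) then length (allFin (pins Γ)) else 0) + (if does (δ ℕ.≟ d) then length grid else 0)
    ≡⟨ cong₂ _+_ (cong (λ l → if does (Δ ℕ.≟ d) then l else 0) (List.length-tabulate {n = pins Γ} (λ p → p)))
                 (cong (λ l → if does (δ ℕ.≟ d) then l else 0) grid-size) ⟩
      (if does (Δ ℕ.≟ d) then pins Γ else 0) + (if does (δ ℕ.≟ d) then verts Γ * M else 0)
    ∎
    where
    open ≡-Reasoning
    has-d : D → Bool
    has-d X = does (degreeD Γ M X ℕ.≟ d)
    grid = cartesianProduct (allFin (verts Γ)) (allFin M)
    grid-size : length grid ≡ verts Γ * M
    grid-size = trans (length-cartesianProduct (allFin (verts Γ)) (allFin M))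
                      (cong₂ _*_ (List.length-tabulate {n = verts Γ} (λ u → u))
                                 (List.length-tabulate {n = M} (λ i → i)))

  _≟E_ : DecidableEquality (D × D)
  _≟E_ = Product.≡-dec _≟D_ _≟D_

  base : D → BVert Γ
  base (inj₁ p)       = inj₁ p
  base (inj₂ (u , _)) = inj₂ u

  -- a pinned vertex has no index; the value given to it is never used
  lift-index : D → Fin M
  lift-index (inj₁ _)       = Fin.zero
  lift-index (inj₂ (_ , i)) = i

  arcLift-hits-once : ∀ X Y v w a → tally (λ e → does (e ≟E (X , Y))) (arcLift (v , w , a))
                                     ≤ (if does (inj₂ v ≟B base X) ∧ does (inj₂ w ≟B base Y) then 1 else 0)
  arcLift-hits-once X Y v w a =
    ℕ.≤-trans (ℕ.≤-reflexive (tally-arcLift _ v w a)) (tally-allFin-≤ _ (lift-index X) (hit X Y))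
    where
    hit : ∀ X Y i → T (does ((inj₂ (v , i) , inj₂ (w , shift i a)) ≟E (X , Y))) →
          T (does (inj₂ v ≟B base X) ∧ does (inj₂ w ≟B base Y)) × i ≡ lift-index X
    hit X Y i h with T-does⁻ ((inj₂ (v , i) , inj₂ (w , shift i a)) ≟E (X , Y)) h
    ... | refl = Equivalence.from T-∧ (T-does⁺ (inj₂ v ≟B inj₂ v) refl , T-does⁺ (inj₂ w ≟B inj₂ w) refl) , refl

  pinLift-hits-once : ∀ X Y p w → tally (λ e → does (e ≟E (X , Y))) (pinLift (p , w))
                                   ≤ (if does (inj₁ p ≟B base X) ∧ does (inj₂ w ≟B base Y) then 1 else 0)
  pinLift-hits-once X Y p w =
    ℕ.≤-trans (ℕ.≤-reflexive (tally-pinLift _ p w)) (tally-allFin-≤ _ (lift-index Y) (hit X Y))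
    where
    hit : ∀ X Y i → T (does ((inj₁ p , inj₂ (w , i)) ≟E (X , Y))) →
          T (does (inj₁ p ≟B base X) ∧ does (inj₂ w ≟B base Y)) × i ≡ lift-index Y
    hit X Y i h with T-does⁻ ((inj₁ p , inj₂ (w , i)) ≟E (X , Y)) h
    ... | refl = Equivalence.from T-∧ (T-does⁺ (inj₁ p ≟B inj₁ p) refl , T-does⁺ (inj₂ w ≟B inj₂ w) refl) , refl

  tally-directed : ∀ X Y → tally (λ e → does (e ≟E (X , Y))) es ≤ edgesFromTo Γ (base X) (base Y)
  tally-directed X Y = ℕ.≤-trans (ℕ.≤-reflexive (tally-derivedEdges _))
    (ℕ.+-mono-≤ (tally-concatMap-≤ (λ (v , w , a) → arcLift-hits-once X Y v w a) (arcs Γ))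
                (tally-concatMap-≤ (λ (p , w) → pinLift-hits-once X Y p w) (pinEdges Γ)))

  joins? : D → D → D × D → Bool
  joins? X Y e = does (e ≟E (X , Y)) ∨ does (e ≟E (Y , X))

  tally-joins : ∀ X Y → tally (joins? X Y) es ≤ multiplicity Γ (base X) (base Y)
  tally-joins X Y = ℕ.≤-trans (tally-∨ _ _ es) (ℕ.+-mono-≤ (tally-directed X Y) (tally-directed Y X))

  data Lift : D × D → Set where
    arc : ∀ {v w a} → (v , w , a) ∈ arcs Γ → ∀ i → Lift (inj₂ (v , i) , inj₂ (w , shift i a))
    pin : ∀ {p w} → (p , w) ∈ pinEdges Γ → ∀ i → Lift (inj₁ p , inj₂ (w , i))

  lift-view : ∀ {e} → e ∈ es → Lift e
  lift-view e∈ with ∈-++⁻ (concatMap arcLift (arcs Γ)) e∈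
  ... | inj₁ e∈arcs with find (∈-concatMap⁻ arcLift {xs = arcs Γ} e∈arcs)
  ...   | _ , α∈ , e∈α with ∈-map⁻ _ e∈α
  ...     | i , _ , refl = arc α∈ i
  lift-view e∈ | inj₂ e∈pins with find (∈-concatMap⁻ pinLift {xs = pinEdges Γ} e∈pins)
  ...   | _ , π∈ , e∈π with ∈-map⁻ _ e∈π
  ...     | i , _ , refl = pin π∈ i

  arcLift-∈ : ∀ {v w a} → (v , w , a) ∈ arcs Γ → ∀ i → (inj₂ (v , i) , inj₂ (w , shift i a)) ∈ es
  arcLift-∈ α∈ i = ∈-++⁺ˡ (∈-concatMap⁺ arcLift (Any.map (λ { refl → ∈-map⁺ _ (∈-allFin i) }) α∈))

  pinLift-∈ : ∀ {p w} → (p , w) ∈ pinEdges Γ → ∀ i → (inj₁ p , inj₂ (w , i)) ∈ es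
  pinLift-∈ π∈ i = ∈-++⁺ʳ (concatMap arcLift (arcs Γ))
    (∈-concatMap⁺ pinLift (Any.map (λ { refl → ∈-map⁺ _ (∈-allFin i) }) π∈))

  Follows : ℤ → D → D → Set
  Follows t (inj₂ (_ , i)) (inj₂ (_ , j)) = j ≡ shift i t
  Follows t _              _              = ⊤

  record Step (X Y : D) : Set where
    field
      voltage : ℤ
      dart    : (base Y , voltage) ∈ darts Γ (base X)
      follows : Follows voltage X Y

  lift-step : ∀ {e X Y} → Lift e → Joins e X Y → Step X Y
  lift-step (arc {a = a} α∈ i) (inj₁ (refl , refl)) = record
    { voltage = a
    ; dart    = ∈-++⁺ˡ (∈-map⁺ _ (∈-filter⁺ _ α∈ refl))
    ; follows = refl }
  lift-step (arc {a = a} α∈ i) (inj₂ (refl , refl)) = record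
    { voltage = - a
    ; dart    = ∈-++⁺ʳ (outgoing Γ _) (∈-++⁺ˡ (∈-map⁺ _ (∈-filter⁺ _ α∈ refl)))
    ; follows = sym (shift-inverseʳ i a) }
  lift-step (pin π∈ i) (inj₁ (refl , refl)) = record
    { voltage = + 0
    ; dart    = ∈-map⁺ _ (∈-filter⁺ _ π∈ refl)
    ; follows = _ }
  lift-step (pin π∈ i) (inj₂ (refl , refl)) = record
    { voltage = + 0
    ; dart    = ∈-++⁺ʳ (outgoing Γ _) (∈-++⁺ʳ (incoming Γ _) (∈-map⁺ _ (∈-filter⁺ _ π∈ refl)))
    ; follows = _ }

  edge-step : ∀ {e X Y} → e ∈ es → Joins e X Y → Step X Y
  edge-step e∈ = lift-step (lift-view e∈)

-- Cycles as closed walks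

module _ {k : ℕ} where

  toℕ-next : ∀ (i : Fin (suc k)) → toℕ i < k → toℕ (next i) ≡ suc (toℕ i)
  toℕ-next i i<k with toℕ i ℕ.<? k
  ... | yes i<k′ = cong suc (toℕ-fromℕ< i<k′)
  ... | no  i≮k  = contradiction i<k i≮k

  next-last : ∀ (i : Fin (suc k)) → toℕ i ≡ k → next i ≡ Fin.zero
  next-last i i≡k with toℕ i ℕ.<? k
  ... | yes i<k = contradiction i≡k (ℕ.<⇒≢ i<k)
  ... | no  _   = refl

module ClosedWalk {V : Set} {k : ℕ} (v : Fin (suc k) → V) (v-injective : Injective _≡_ _≡_ v) where

  position : ℕ → Fin (suc k)
  position zero    = Fin.zero
  position (suc i) = next (position i)

  walk : ℕ → V
  walk i = v (position i)

  toℕ-position : ∀ {i} → i ≤ k → toℕ (position i) ≡ i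
  toℕ-position {zero}  _       = refl
  toℕ-position {suc i} 1+i≤k = trans (toℕ-next (position i) (subst (_< k) (sym i≡) 1+i≤k)) (cong suc i≡)
    where i≡ = toℕ-position (ℕ.<⇒≤ 1+i≤k)

  position-wraps : position (suc k) ≡ Fin.zero
  position-wraps = next-last (position k) (toℕ-position ℕ.≤-refl)

  walk-injective : ∀ {i j} → i ≤ k → j ≤ k → walk i ≡ walk j → i ≡ j
  walk-injective {i} {j} i≤k j≤k eq =
    trans (sym (toℕ-position i≤k)) (trans (cong toℕ (v-injective eq)) (toℕ-position j≤k))

  walk-wraps : walk (suc k) ≡ walk 0
  walk-wraps = cong v position-wraps

  walk-wraps₁ : walk (2 + k) ≡ walk 1
  walk-wraps₁ = cong (v ∘ next) position-wraps

  walk-nonbacktracking : 2 ≤ k → ∀ {j} → j ≤ k → walk j ≢ walk (2 + j)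
  walk-nonbacktracking 2≤k {j} j≤k with ℕ.m≤n⇒m<n∨m≡n j≤k
  ... | inj₂ refl = λ eq → contradiction (walk-injective ℕ.≤-refl (ℕ.<⇒≤ 2≤k) (trans eq walk-wraps₁))
                                          λ { refl → ℕ.<-irrefl refl 2≤k }
  ... | inj₁ j<k with ℕ.m≤n⇒m<n∨m≡n j<k
  ...   | inj₁ 2+j≤k = λ eq → ℕ.<-irrefl refl
                                (subst (_< 2 + j) (walk-injective j≤k 2+j≤k eq) (ℕ.m≤n⇒m≤1+n (ℕ.n<1+n j)))
  ...   | inj₂ refl  = λ eq → contradiction (walk-injective j≤k z≤n (trans eq walk-wraps))
                                            λ { refl → ℕ.<-irrefl refl 2≤k }

module _ {V : Set} (_≟_ : DecidableEquality V) where

  Joins? : ∀ e X Y → Dec (Joins e X Y)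
  Joins? (A , B) X Y = ((A ≟ X) ×-dec (B ≟ Y)) ⊎-dec ((A ≟ Y) ×-dec (B ≟ X))

  injective? : ∀ {k} (f : Fin k → V) → Dec (∀ i j → f i ≡ f j → i ≡ j)
  injective? f = all? λ i → all? λ j → (f i ≟ f j) →-dec (i ≟F j)

-- Reduced closed walks in the base graph

module _ (Γ : VoltageGraph) where
  private
    _≟B_ = BVert-≟ Γ

  -- At a pinned vertex a walk may turn back along the edge it came by: the lifts of that edge end at
  -- different lifts of its other end.
  reverses : BVert Γ → Dart Γ → Dart Γ → Bool
  reverses p (c , t) (w , t′) = not (isPinned Γ c) ∧ does (w ≟B p) ∧ does (t′ ℤ.≟ - t)

  -- The offset of a walk is the sum of its voltages, or nothing once it has met a pinned vertex.
  origin : BVert Γ → Maybe ℤ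
  origin s = if isPinned Γ s then nothing else just (+ 0)

  advance : Maybe ℤ → Dart Γ → Maybe ℤ
  advance o (w , t) = if isPinned Γ w then nothing else Maybe.map (ℤ._+ t) o

  allBVert : List (BVert Γ)
  allBVert = map inj₁ (allFin (pins Γ)) ++ map inj₂ (allFin (verts Γ))

  ∈-allBVert : ∀ b → b ∈ allBVert
  ∈-allBVert (inj₁ p) = ∈-++⁺ˡ (∈-map⁺ inj₁ (∈-allFin p))
  ∈-allBVert (inj₂ u) = ∈-++⁺ʳ (map inj₁ (allFin (pins Γ))) (∈-map⁺ inj₂ (∈-allFin u))

  dartTable : Vec (List (Dart Γ)) (pins Γ) → Vec (List (Dart Γ)) (verts Γ) → BVert Γ → List (Dart Γ)
  dartTable P V (inj₁ p) = Vec.lookup P p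
  dartTable P V (inj₂ u) = Vec.lookup V u

  -- Passed to the search as an argument, this table is computed once and then shared, whereas
  -- darts would be recomputed at every step of every walk.
  tabulatedDarts : BVert Γ → List (Dart Γ)
  tabulatedDarts = dartTable (Vec.tabulate (darts Γ ∘ inj₁)) (Vec.tabulate (darts Γ ∘ inj₂))

  tabulatedDarts-correct : ∀ b → tabulatedDarts b ≡ darts Γ b
  tabulatedDarts-correct (inj₁ p) = lookup∘tabulate (darts Γ ∘ inj₁) p
  tabulatedDarts-correct (inj₂ u) = lookup∘tabulate (darts Γ ∘ inj₂) u

  module Explore (B : ℕ) (adj : BVert Γ → List (Dart Γ)) where

    shortNonzero : Maybe ℤ → Bool
    shortNonzero nothing  = false
    shortNonzero (just t) = (0 <ᵇ ∣ t ∣) ∧ (∣ t ∣ <ᵇ B)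

    closes : BVert Γ → Dart Γ → BVert Γ → Dart Γ → Maybe ℤ → Bool
    closes s d₁ p d o = not (does (proj₁ d ≟B s)) ∨ reverses p d d₁ ∨ shortNonzero o

    -- explore r s d₁ p d o: a walk left s by the dart d₁, has just followed the dart d from p, and
    -- has offset o.  Every extension of it by at most r darts without reversing one may come back
    -- to s only by reversing d₁ or with a nonzero offset shorter than B.
    explore : ℕ → BVert Γ → Dart Γ → BVert Γ → Dart Γ → Maybe ℤ → Bool
    explore zero    s d₁ p d o = closes s d₁ p d o
    explore (suc r) s d₁ p d o = closes s d₁ p d o ∧
      all (λ d′ → reverses p d d′ ∨ explore r s d₁ (proj₁ d) d′ (advance o d′)) (adj (proj₁ d))

    allClose : ℕ → Bool
    allClose r = all (λ s → all (λ d₁ → explore r s d₁ s d₁ (advance (origin s) d₁)) (adj s)) allBVert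

  ReducedWalksClose : ℕ → ℕ → Set
  ReducedWalksClose B r = Explore.allClose B tabulatedDarts r ≡ true

  -- A loop at b counts twice in multiplicity b b, so a simple base graph has no loops.
  Simple : Set
  Simple = ∀ b c → multiplicity Γ b c ≤ 1

module _ (Γ : VoltageGraph) (n : ℕ) where
  private
    M = suc n
    D = DVert Γ M
    es = derivedEdges Γ M
    _≟B_ = BVert-≟ Γ

  Offset : Maybe ℤ → D → D → Set
  Offset nothing  _              _              = ⊤
  Offset (just t) (inj₂ (_ , i)) (inj₂ (_ , j)) = j ≡ shift i t
  Offset (just _) _              _              = ⊥

  offset-origin : ∀ X → Offset (origin Γ (base Γ n X)) X X
  offset-origin (inj₁ _)       = _
  offset-origin (inj₂ (_ , i)) = sym (shift-identityʳ i)

  offset-advance : ∀ {o X₀ X Y} → Offset o X₀ X → (st : Step Γ n X Y) →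
                   Offset (advance Γ o (base Γ n Y , Step.voltage st)) X₀ Y
  offset-advance {nothing} {Y = inj₁ _} _ _ = _
  offset-advance {nothing} {Y = inj₂ _} _ _ = _
  offset-advance {just _} {inj₂ _} {inj₂ _} {inj₁ _} _ _ = _
  offset-advance {just t} {inj₂ (_ , i₀)} {inj₂ (_ , i)} {inj₂ _} i≡ st =
    trans (Step.follows st) (trans (cong (λ j → shift j (Step.voltage st)) i≡) (shift-+ i₀ t (Step.voltage st)))
  offset-advance {just _} {inj₁ _} ()
  offset-advance {just _} {inj₂ _} {inj₁ _} ()

  reverses-returns : ∀ {X Y Z} (s₁ : Step Γ n X Y) (s₂ : Step Γ n Y Z) →
    T (reverses Γ (base Γ n X) (base Γ n Y , Step.voltage s₁) (base Γ n Z , Step.voltage s₂)) → Z ≡ X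
  reverses-returns {X} {inj₂ _} {Z} s₁ s₂ rev
    with Equivalence.to T-∧ rev
  ... | same-base , opposite = back X Z (T-does⁻ (base Γ n Z ≟B base Γ n X) same-base)
                                   (Step.follows s₁) (Step.follows s₂)
                                   (T-does⁻ (Step.voltage s₂ ℤ.≟ - Step.voltage s₁) opposite)
    where
    back : ∀ X Z → base Γ n Z ≡ base Γ n X →
           Follows Γ n (Step.voltage s₁) X _ → Follows Γ n (Step.voltage s₂) _ Z →
           Step.voltage s₂ ≡ - Step.voltage s₁ → Z ≡ X
    back (inj₁ _) (inj₁ _) refl _ _ _ = refl
    back (inj₂ (_ , i)) (inj₂ _) refl i′≡ k≡ t₂≡ = cong (λ j → inj₂ (_ , j))
      (trans k≡ (trans (cong₂ shift i′≡ t₂≡) (shift-inverseʳ i (Step.voltage s₁))))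

  module _ (B : ℕ) (adj : BVert Γ → List (Dart Γ)) (adj-darts : ∀ b → adj b ≡ darts Γ b) (B≤M : B ≤ M) where
    open Explore Γ B adj

    shortNonzero-offset : ∀ {o X} → Offset o X X → ¬ T (shortNonzero o)
    shortNonzero-offset {just t} {inj₂ (_ , i)} i≡ short with Equivalence.to T-∧ short
    ... | 0<∣t∣ , ∣t∣<B =
      shift-≢ i {t} (ℕ.<ᵇ⇒< 0 ∣ t ∣ 0<∣t∣) (ℕ.<-≤-trans (ℕ.<ᵇ⇒< ∣ t ∣ B ∣t∣<B) B≤M) (sym i≡)

    explore-closes : ∀ f s d₁ p d o → T (explore f s d₁ p d o) → T (closes s d₁ p d o)
    explore-closes zero    _ _  _ _ _ ok = ok
    explore-closes (suc f) _ _  _ _ _ ok = proj₁ (Equivalence.to T-∧ ok)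

    explore-continues : ∀ f s d₁ p d o {d′} → T (explore (suc f) s d₁ p d o) → d′ ∈ adj (proj₁ d) →
      T (reverses Γ p d d′) ⊎ T (explore f s d₁ (proj₁ d) d′ (advance Γ o d′))
    explore-continues f s d₁ p d o ok d′∈ = Equivalence.to T-∨
      (T-all-∈ (λ d′ → reverses Γ p d d′ ∨ explore f s d₁ (proj₁ d) d′ (advance Γ o d′))
               (proj₂ (Equivalence.to (T-∧ {closes s d₁ p d o}) ok)) d′∈)

    walks⇒no-cycle : ∀ r → allClose r ≡ true → ∀ k → 2 ≤ k → k ≤ r → ¬ HasCycle es (suc k)
    walks⇒no-cycle r ok k 2≤k k≤r (v , e , v-injective , _ , joins) =
      closing (r ∸ k) (reach k (r ∸ k) (ℕ.m+[n∸m]≡n k≤r) ℕ.≤-refl)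
      where
      open ClosedWalk v v-injective

      cycle-step : ∀ i → Step Γ n (v i) (v (next i))
      cycle-step i = edge-step Γ n (∈-lookup (e i)) (joins i)

      step : ∀ j → Step Γ n (walk j) (walk (suc j))
      step j = cycle-step (position j)

      dart : ℕ → Dart Γ
      dart j = base Γ n (walk (suc j)) , Step.voltage (step j)

      dart-∈ : ∀ j → dart j ∈ adj (base Γ n (walk j))
      dart-∈ j = subst (dart j ∈_) (sym (adj-darts _)) (Step.dart (step j))

      dart-wraps : dart (suc k) ≡ dart 0
      dart-wraps = cong (λ i → base Γ n (v (next i)) , Step.voltage (cycle-step i)) position-wraps

      s = base Γ n (walk 0)

      Reached : ℕ → ℕ → Set
      Reached j f = Σ (Maybe ℤ) λ o →
        Offset o (walk 0) (walk (suc j)) × T (explore f s (dart 0) (base Γ n (walk j)) (dart j) o)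

      reach : ∀ j f → j + f ≡ r → j ≤ k → Reached j f
      reach zero f refl _ = _ , offset-advance (offset-origin (walk 0)) (step 0) , start
        where
        start : T (explore r s (dart 0) s (dart 0) (advance Γ (origin Γ s) (dart 0)))
        start = T-all-∈ (λ d₁ → explore r s d₁ s d₁ (advance Γ (origin Γ s) d₁))
                  (T-all-∈ (λ s → all (λ d₁ → explore r s d₁ s d₁ (advance Γ (origin Γ s) d₁)) (adj s))
                           (Equivalence.from T-≡ ok) (∈-allBVert Γ s)) (dart-∈ 0)
      reach (suc j) f j+1+f≡r j<k with reach j (suc f) (trans (ℕ.+-suc j f) j+1+f≡r) (ℕ.<⇒≤ j<k)
      ... | o , offset , explored
        with explore-continues f s (dart 0) (base Γ n (walk j)) (dart j) o explored (dart-∈ (suc j))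
      ...   | inj₁ back = contradiction (reverses-returns (step j) (step (suc j)) back)
                                        (≢-sym (walk-nonbacktracking 2≤k (ℕ.<⇒≤ j<k)))
      ...   | inj₂ next-ok = _ , offset-advance offset (step (suc j)) , next-ok

      closing : ∀ f → Reached k f → ⊥
      closing f (o , offset , explored)
        with Equivalence.to T-∨ (explore-closes f s (dart 0) (base Γ n (walk k)) (dart k) o explored)
      ... | inj₁ open-walk = T-not-does⁻ (base Γ n (walk (suc k)) ≟B s) open-walk (cong (base Γ n) walk-wraps)
      ... | inj₂ rest with Equivalence.to T-∨ rest
      ...   | inj₁ back = walk-nonbacktracking 2≤k ℕ.≤-refl
              (sym (reverses-returns (step k) (step (suc k))
                     (subst (T ∘ reverses Γ (base Γ n (walk k)) (dart k)) (sym dart-wraps) back)))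
      ...   | inj₂ short = shortNonzero-offset (subst (Offset o (walk 0)) walk-wraps offset) short

  Joins-self : ∀ {e : D × D} {X} → Joins e X X → e ≡ (X , X)
  Joins-self (inj₁ (refl , refl)) = refl
  Joins-self (inj₂ (refl , refl)) = refl

  Joins⇒joins? : ∀ {e : D × D} {X Y} → Joins e X Y → T (joins? Γ n X Y e)
  Joins⇒joins? {e} (inj₁ (refl , refl)) = Equivalence.from T-∨ (inj₁ (T-does⁺ (_≟E_ Γ n e e) refl))
  Joins⇒joins? {e} (inj₂ (refl , refl)) = Equivalence.from T-∨ (inj₂ (T-does⁺ (_≟E_ Γ n e e) refl))

  no-loops : Simple Γ → ¬ HasCycle es 1
  no-loops simple (v , e , _ , _ , joins) = contradiction two≤one λ { (s≤s ()) }
    where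
    X = v Fin.zero
    loops = edgesFromTo Γ (base Γ n X) (base Γ n X)
    one≤loops : 1 ≤ loops
    one≤loops = ℕ.≤-trans
      (tally-lookup _ es (e Fin.zero) (T-does⁺ (_≟E_ Γ n _ (X , X)) (Joins-self (joins Fin.zero))))
      (tally-directed Γ n X X)
    two≤one : 2 ≤ 1
    two≤one = ℕ.≤-trans (ℕ.+-mono-≤ one≤loops one≤loops) (simple (base Γ n X) (base Γ n X))

  no-digons : Simple Γ → ¬ HasCycle es 2
  no-digons simple (v , e , _ , e-injective , joins) = contradiction two≤one λ { (s≤s ()) }
    where
    X = v Fin.zero
    Y = v (Fin.suc Fin.zero)
    two≤one : 2 ≤ 1
    two≤one = ℕ.≤-trans
      (tally-lookup₂ (joins? Γ n X Y) es (0≢1+n ∘ e-injective)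
        (Joins⇒joins? (joins Fin.zero)) (Joins⇒joins? (swap (joins (Fin.suc Fin.zero)))))
      (ℕ.≤-trans (tally-joins Γ n X Y) (simple (base Γ n X) (base Γ n Y)))

  no-short-cycles : ∀ B r → Simple Γ → ReducedWalksClose Γ B r → B ≤ M → ∀ k → k < 2 + r → ¬ HasCycle es k
  no-short-cycles B r simple walks B≤M zero                      _  ()
  no-short-cycles B r simple walks B≤M (suc zero)                _  = no-loops simple
  no-short-cycles B r simple walks B≤M (suc (suc zero))          _  = no-digons simple
  no-short-cycles B r simple walks B≤M (suc (suc (suc k))) (s≤s (s≤s k+3≤r)) =
    walks⇒no-cycle B (tabulatedDarts Γ) (tabulatedDarts-correct Γ) B≤M r walks (2 + k) (s≤s (s≤s z≤n)) k+3≤r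

-- The voltage graph H₁₂

H12-simple : Simple H12
H12-simple = from-yes (all-BVert? H12 λ b → all-BVert? H12 λ c → multiplicity H12 b c ℕ.≤? 1)

H12-short-walks : ReducedWalksClose H12 10 10
H12-short-walks = refl

module _ (n : ℕ) where
  private
    M = suc n

  H12-degree-lift : ∀ u j → degreeD H12 M (inj₂ (u , j)) ≡ 3
  H12-degree-lift u j = trans (degree-lift H12 n u j)
    (from-yes (all? λ u → length (darts H12 (inj₂ u)) ℕ.≟ 3) u)

  H12-degree-pinned : ∀ p → degreeD H12 M (inj₁ p) ≡ M
  H12-degree-pinned p = trans (degree-pinned H12 n p)
    (trans (cong (_* M) (from-yes (all? λ p → length (darts H12 (inj₁ p)) ℕ.≟ 1) p)) (ℕ.*-identityˡ M))

  H12-degree-counts : 3 ≢ M → numOfDegree H12 M M ≡ 3 × numOfDegree H12 M 3 ≡ 41 * M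
  H12-degree-counts 3≢M =
      trans (numOfDegree-≡ H12 n H12-degree-pinned H12-degree-lift M)
            (cong₂ _+_ (cong (λ b → if b then 3 else 0) (dec-true (M ℕ.≟ M) refl))
                       (cong (λ b → if b then 41 * M else 0) (dec-false (3 ℕ.≟ M) 3≢M)))
    , trans (numOfDegree-≡ H12 n H12-degree-pinned H12-degree-lift 3)
            (cong₂ _+_ (cong (λ b → if b then 3 else 0) (dec-false (M ℕ.≟ 3) (3≢M ∘ sym)))
                       (cong (λ b → if b then 41 * M else 0) (dec-true (3 ℕ.≟ 3) refl)))

module _ (n : ℕ) where
  private
    M = suc (suc n)
    D = DVert H12 M
    es = derivedEdges H12 M
    ₀ ₁ : Fin M
    ₀ = Fin.zero
    ₁ = Fin.suc Fin.zero
    arc-≟ : DecidableEquality (Fin 41 × Fin 41 × ℤ)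
    arc-≟ = Product.≡-dec _≟F_ (Product.≡-dec _≟F_ ℤ._≟_)
    pinEdge-≟ : DecidableEquality (Fin 3 × Fin 41)
    pinEdge-≟ = Product.≡-dec _≟F_ _≟F_
    module Arcs = DecMembership arc-≟
    module Pins = DecMembership pinEdge-≟

  twelve-cycle-vertices : Vec D 12
  twelve-cycle-vertices =
    inj₁ xStar ∷ inj₂ (x , ₀) ∷ inj₂ (x0 , ₀) ∷ inj₂ (x00 , ₀) ∷ inj₂ (y0 , ₀) ∷ inj₂ (y , ₀) ∷
    inj₁ yStar ∷ inj₂ (y , ₁) ∷ inj₂ (y0 , ₁) ∷ inj₂ (x00 , ₁) ∷ inj₂ (x0 , ₁) ∷ inj₂ (x , ₁) ∷ []

  twelve-cycle-edges : Vec (D × D) 12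
  twelve-cycle-edges =
    (inj₁ xStar , inj₂ (x , ₀)) ∷ lift x x0 ₀ ∷ lift x0 x00 ₀ ∷ lift x00 y0 ₀ ∷ lift y y0 ₀ ∷
    (inj₁ yStar , inj₂ (y , ₀)) ∷ (inj₁ yStar , inj₂ (y , ₁)) ∷ lift y y0 ₁ ∷ lift x00 y0 ₁ ∷
    lift x0 x00 ₁ ∷ lift x x0 ₁ ∷ (inj₁ xStar , inj₂ (x , ₁)) ∷ []
    where
    lift : Fin 41 → Fin 41 → Fin M → D × D
    lift v w i = inj₂ (v , i) , inj₂ (w , shift i (+ 0))

  twelve-cycle-edges-∈ : All (_∈ es) twelve-cycle-edges
  twelve-cycle-edges-∈ =
    pinLift-∈ H12 (suc n) x-pin ₀ ∷ arcLift-∈ H12 (suc n) x-x0 ₀ ∷ arcLift-∈ H12 (suc n) x0-x00 ₀ ∷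
    arcLift-∈ H12 (suc n) x00-y0 ₀ ∷ arcLift-∈ H12 (suc n) y-y0 ₀ ∷ pinLift-∈ H12 (suc n) y-pin ₀ ∷
    pinLift-∈ H12 (suc n) y-pin ₁ ∷ arcLift-∈ H12 (suc n) y-y0 ₁ ∷ arcLift-∈ H12 (suc n) x00-y0 ₁ ∷
    arcLift-∈ H12 (suc n) x0-x00 ₁ ∷ arcLift-∈ H12 (suc n) x-x0 ₁ ∷ pinLift-∈ H12 (suc n) x-pin ₁ ∷ []
    where
    x-x0   : (x , x0 , + 0) ∈ arcs H12
    x-x0   = from-yes ((x , x0 , + 0) Arcs.∈? arcs H12)
    x0-x00 : (x0 , x00 , + 0) ∈ arcs H12
    x0-x00 = from-yes ((x0 , x00 , + 0) Arcs.∈? arcs H12)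
    x00-y0 : (x00 , y0 , + 0) ∈ arcs H12
    x00-y0 = from-yes ((x00 , y0 , + 0) Arcs.∈? arcs H12)
    y-y0   : (y , y0 , + 0) ∈ arcs H12
    y-y0   = from-yes ((y , y0 , + 0) Arcs.∈? arcs H12)
    x-pin  : (xStar , x) ∈ pinEdges H12
    x-pin  = from-yes ((xStar , x) Pins.∈? pinEdges H12)
    y-pin  : (yStar , y) ∈ pinEdges H12
    y-pin  = from-yes ((yStar , y) Pins.∈? pinEdges H12)

  twelve-cycle : HasCycle es 12
  twelve-cycle = vertex , edge , vertex-injective , edge-injective , joins
    where
    vertex = Vec.lookup twelve-cycle-vertices
    edge-∈ : ∀ j → Vec.lookup twelve-cycle-edges j ∈ es
    edge-∈ j = lookup⁺ twelve-cycle-edges-∈ j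
    edge : Fin 12 → Fin (length es)
    edge j = index (edge-∈ j)
    edge-lookup : ∀ j → lookup es (edge j) ≡ Vec.lookup twelve-cycle-edges j
    edge-lookup j = sym (lookup-index (edge-∈ j))
    vertex-injective : Injective _≡_ _≡_ vertex
    vertex-injective {i} {j} = from-yes (injective? (DVert-≟ H12 M) vertex) i j
    edge-injective : Injective _≡_ _≡_ edge
    edge-injective {i} {j} eq = from-yes (injective? (_≟E_ H12 (suc n)) (Vec.lookup twelve-cycle-edges)) i j
      (trans (sym (edge-lookup i)) (trans (cong (lookup es) eq) (edge-lookup j)))
    joins : ∀ j → Joins (lookup es (edge j)) (vertex j) (vertex (next j))
    joins j = subst (λ e → Joins e (vertex j) (vertex (next j))) (sym (edge-lookup j))
      (from-yes (all? λ j → Joins? (DVert-≟ H12 M) (Vec.lookup twelve-cycle-edges j) (vertex j) (vertex (next j)))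
                j)

theorem7 : (m : ℕ) → 10 ≤ m →
    HasGirth (derivedEdges H12 m) 12
    × Is3mGraph H12 m 12
    × degreeD H12 m (inj₁ xStar) ≡ m
    × degreeD H12 m (inj₁ yStar) ≡ m
    × degreeD H12 m (inj₁ zStar) ≡ m
    × numOfDegree H12 m m ≡ 3
    × numOfDegree H12 m 3 ≡ 41 * m
theorem7 (suc zero) (s≤s ())
theorem7 m@(suc (suc n)) 10≤m =
  girth , (girth , degree-3-or-m) ,
  H12-degree-pinned (suc n) xStar , H12-degree-pinned (suc n) yStar , H12-degree-pinned (suc n) zStar ,
  H12-degree-counts (suc n) (ℕ.<⇒≢ (ℕ.<-≤-trans (ℕ.<ᵇ⇒< 3 10 _) 10≤m))
  where
  girth : HasGirth (derivedEdges H12 m) 12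
  girth = twelve-cycle n , no-short-cycles H12 (suc n) 10 10 H12-simple H12-short-walks 10≤m
  degree-3-or-m : ∀ X → degreeD H12 m X ≡ 3 ⊎ degreeD H12 m X ≡ m
  degree-3-or-m (inj₁ p)       = inj₂ (H12-degree-pinned (suc n) p)
  degree-3-or-m (inj₂ (u , j)) = inj₁ (H12-degree-lift (suc n) u j)
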